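{- Let $\mathcal P\in\beta N$ be a prime ultrafilter (i.e. $P\in\mathcal P$) and let $\mathcal F,\mathcal G\in\beta N$. If $\mathcal P\,\widetilde{\mid}\,\mathcal F\cdot\mathcal G$, then $\mathcal P\,\widetilde{\mid}\,\mathcal F$ or $\mathcal P\,\widetilde{\mid}\,\mathcal G$.
   Context: $N=\{1,2,3,\dots\}$, $P$ is the set of primes, $\beta N$ is the set of ultrafilters on $N$. For $A\subseteq N$, $n\in N$: $A/n=\{m\in N:mn\in A\}$; the product of ultrafilters is given by $A\in\mathcal F\cdot\mathcal G\iff\{n\in N:A/n\in\mathcal G\}\in\mathcal F$. For $A\subseteq N$, $A\uparrow=\{n\in N:\exists a\in A\ a\mid n\}$, and $\mathcal U=\{A\subseteq N: A\uparrow=A\}$. The divisibility relation on $\beta N$ is $\mathcal F\,\widetilde{\mid}\,\mathcal G\iff\mathcal F\cap\mathcal U\subseteq\mathcal G$. -}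

module Defs where

open import Level using (0ℓ)
open import Data.Nat using (ℕ; _*_; NonZero)
open import Data.Nat.Divisibility using (_∣_)
open import Data.Product using (Σ; _×_)
open import Data.Sum using (_⊎_)
open import Relation.Nullary using (¬_)
open import Relation.Unary using (Pred; _⊆_; _∩_; ∅; ∁)

-- Subsets of ℕ.  The paper's N = {1,2,...} is modelled by ultrafilters on ℕ
-- that contain the set of nonzero numbers.
Subset : Set₁
Subset = Pred ℕ 0ℓ

record Ultrafilter : Set₂ where
  field
    mem      : Subset → Set
    upward   : ∀ {A B : Subset} → A ⊆ B → mem A → mem B
    inter    : ∀ {A B : Subset} → mem A → mem B → mem (A ∩ B)
    proper   : ¬ mem ∅
    ultra    : ∀ (A : Subset) → mem A ⊎ mem (∁ A)
    positive : mem (λ n → NonZero n)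

open Ultrafilter public

_/_ : Subset → ℕ → Subset
(A / n) m = A (m * n)

_·_ : Ultrafilter → Ultrafilter → Subset → Set
(F · G) A = mem F (λ n → mem G (A / n))

_↑ : Subset → Subset
(A ↑) n = Σ ℕ (λ a → A a × a ∣ n)

𝒰 : Pred Subset 0ℓ
𝒰 A = ((A ↑) ⊆ A) × (A ⊆ (A ↑))

_∣̃_ : (Subset → Set) → (Subset → Set) → Set₁
F ∣̃ G = ∀ (A : Subset) → 𝒰 A → F A → G A

-- Suppose A ∈ 𝒫 ∩ 𝒰 misses F and B ∈ 𝒫 ∩ 𝒰 misses G.  The upward closure C of
-- the primes in A ∩ B still lies in 𝒫 ∩ 𝒰, so C ∈ F · G.  By Euclid's lemma the
-- complement of C is closed under multiplication, and it lies in both F and G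
-- (as C ⊆ A and C ⊆ B), hence the complement of C lies in F · G as well, which
-- is impossible.  Excluded middle is only needed to decide whether 𝒫 ∣̃ F;
-- everything else is constructive because ultrafilter membership is ¬¬-stable.
module Submission where

open import Defs
open import Level using (0ℓ; suc)
open import Axiom.ExcludedMiddle using (ExcludedMiddle)
open import Data.Empty using (⊥; ⊥-elim)
open import Data.Nat using (ℕ; _*_)
open import Data.Nat.Divisibility using (∣-trans; ∣-refl)
open import Data.Nat.Primality using (Prime; euclidsLemma)
open import Data.Product using (_,_; proj₁; proj₂)
open import Data.Sum using (_⊎_; inj₁; inj₂)
open import Function using (_∘_)
open import Relation.Nullary using (¬_; yes; no)
open import Relation.Unary using (_⊆_; _∩_; ∁)

private
  variable
    A B X : Subset
    m n : ℕ

⊆-↑ : X ⊆ X ↑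
⊆-↑ {x = n} Xn = n , Xn , ∣-refl

↑-𝒰 : 𝒰 (X ↑)
↑-𝒰 = (λ { (a , (x , Xx , x∣a) , a∣n) → x , Xx , ∣-trans x∣a a∣n }) , ⊆-↑

↑-least : (B ↑) ⊆ B → A ⊆ B → A ↑ ⊆ B
↑-least B↑⊆B A⊆B (a , Aa , a∣n) = B↑⊆B (a , A⊆B Aa , a∣n)

∁-↑-*-closed : X ⊆ Prime → ∁ (X ↑) m → ∁ (X ↑) n → ∁ (X ↑) (m * n)
∁-↑-*-closed {m = m} {n} X⊆P ¬m ¬n (p , Xp , p∣mn)
  with euclidsLemma m n (X⊆P Xp) p∣mn
... | inj₁ p∣m = ¬m (p , Xp , p∣m)
... | inj₂ p∣n = ¬n (p , Xp , p∣n)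

module _ (F : Ultrafilter) where

  mem-∁ : ¬ mem F X → mem F (∁ X)
  mem-∁ {X} ¬FX with ultra F X
  ... | inj₁ FX  = ⊥-elim (¬FX FX)
  ... | inj₂ F∁X = F∁X

  mem-stable : ¬ ¬ mem F X → mem F X
  mem-stable {X} ¬¬FX with ultra F X
  ... | inj₁ FX  = FX
  ... | inj₂ F∁X = ⊥-elim (¬¬FX λ FX → proper F (upward F (λ (x , ¬x) → ¬x x) (inter F FX F∁X)))

module _ (F G : Ultrafilter) where

  ·-of-*-closed : (∀ {m n} → X m → X n → X (m * n)) → mem F X → mem G X → (F · G) X
  ·-of-*-closed closed FX GX = upward F (λ Xn → upward G (λ Xm → closed Xm Xn) GX) FX

  ·-disjoint-∁ : (F · G) X → ¬ (F · G) (∁ X)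
  ·-disjoint-∁ FGX FG∁X =
    proper F (upward F (λ (GX/n , G∁X/n) → proper G (upward G (λ (x , ¬x) → ¬x x) (inter G GX/n G∁X/n)))
                       (inter F FGX FG∁X))

prime-∣̃-·-witnesses-absurd : (𝒫 F G : Ultrafilter) → mem 𝒫 Prime → mem 𝒫 ∣̃ (F · G) →
  𝒰 A → mem 𝒫 A → ¬ mem F A → 𝒰 B → mem 𝒫 B → ¬ mem G B → ⊥
prime-∣̃-·-witnesses-absurd {A} {B} 𝒫 F G 𝒫P 𝒫∣̃FG uA 𝒫A ¬FA uB 𝒫B ¬GB =
  ·-disjoint-∁ F G {C} (𝒫∣̃FG C ↑-𝒰 𝒫C)
    (·-of-*-closed F G {∁ C} (∁-↑-*-closed proj₁) (mem-∁ F ¬FC) (mem-∁ G ¬GC))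
  where
  C : Subset
  C = (Prime ∩ (A ∩ B)) ↑

  𝒫C : mem 𝒫 C
  𝒫C = upward 𝒫 ⊆-↑ (inter 𝒫 𝒫P (inter 𝒫 𝒫A 𝒫B))

  ¬FC : ¬ mem F C
  ¬FC = ¬FA ∘ upward F (↑-least (proj₁ uA) (proj₁ ∘ proj₂))

  ¬GC : ¬ mem G C
  ¬GC = ¬GB ∘ upward G (↑-least (proj₁ uB) (proj₂ ∘ proj₂))

theorem2p2 : ExcludedMiddle (suc 0ℓ) →
    (𝒫 F G : Ultrafilter) →
    mem 𝒫 Prime →
    mem 𝒫 ∣̃ (F · G) →
    (mem 𝒫 ∣̃ mem F) ⊎ (mem 𝒫 ∣̃ mem G)
theorem2p2 em 𝒫 F G 𝒫P 𝒫∣̃FG with em {mem 𝒫 ∣̃ mem F}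
... | yes 𝒫∣̃F = inj₁ 𝒫∣̃F
... | no ¬𝒫∣̃F = inj₂ λ B uB 𝒫B → mem-stable G λ ¬GB →
  ¬𝒫∣̃F λ A uA 𝒫A → mem-stable F λ ¬FA →
    prime-∣̃-·-witnesses-absurd 𝒫 F G 𝒫P 𝒫∣̃FG uA 𝒫A ¬FA uB 𝒫B ¬GB
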